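{- Let $F$ be an instance of OECMV($p$) with $p$ a fixed constant, let $s_1,\dots,s_k$ be the sets produced (in this order) by the greedy algorithm on $F$, and let $S=\{s_1,\dots,s_k\}$. Let $\mathrm{Opt}$ be an optimal solution of OECMV($p$) on $F$. Define $L(\mathrm{Opt},i)=L(\mathrm{Opt},s_i)\setminus\bigcup_{1\le j<i}L(\mathrm{Opt},j)$ and $L(S,i)=L(s_i)\setminus\bigcup_{1\le j<i}L(S,j)$ for $1\le i\le k$. Then $2|L(\mathrm{Opt},i)|\ge |L(S,i)|$ for every $1\le i\le k$.
   Context: A fingerprint of length $l$ is a vector in $\{0,1,N\}^l$. Two fingerprints $v_1,v_2$ are compatible if for every position $i$ with $v_1[i]\ne v_2[i]$, at least one of $v_1[i],v_2[i]$ equals $N$. A resolution of a fingerprint $v$ is a vector $r\in\{0,1\}^l$ with $r[i]=v[i]$ whenever $v[i]\ne N$. An instance of OECMV($p$) is a finite set $F$ of fingerprints of the same length, each with at most $p$ entries equal to $N$; a feasible solution is a partition of $F$ into sets of pairwise compatible fingerprints; the objective is to minimize the number of unordered pairs of compatible fingerprints lying in different sets of the partition. Greedy algorithm: let $R$ be the set of all $r\in\{0,1\}^l$ that are resolutions of at least one fingerprint of $F$; set $U:=F$; while $U\neq\emptyset$, choose $r\in R$ maximizing the number of fingerprints in $U$ of which $r$ is a resolution, let $s$ be the set of those fingerprints, output $s$ as the next set, and set $U:=U\setminus s$. For a set $s\subseteq F$, $L(s)$ is the set of unordered pairs $\{x,y\}$ of compatible fingerprints of $F$ with exactly one of $x,y$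 in $s$. For a partition $Q$ of $F$, $L(Q)=\bigcup_{q\in Q}L(q)$ (the set of unordered pairs of compatible fingerprints lying in different sets of $Q$), and for $W\subseteq F$, $L(Q,W)$ is the set of pairs $\{x,y\}\in L(Q)$ with at least one of $x,y$ in $W$. -}

module Defs where

open import Data.Bool using (Bool; true; false; _∧_; _∨_; not; _xor_; if_then_else_)
open import Data.Nat using (ℕ; zero; suc; _+_; _≤_; _<ᵇ_; _≡ᵇ_)
open import Data.Fin using (Fin; toℕ)
open import Data.Fin.Properties using (all?)
open import Data.Vec using (Vec; []; _∷_; lookup; tabulate; sum; count)
open import Data.Product using (Σ; _×_)
open import Data.Sum using (_⊎_)
open import Relation.Nullary using (Dec; yes; no; ¬_; does)
open import Relation.Nullary.Decidable using (_⊎-dec_; _→-dec_; ¬?)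
open import Relation.Binary.PropositionalEquality using (_≡_; _≢_; refl)

data Sym : Set where
  𝟘 𝟙 N : Sym

_≟S_ : (a b : Sym) → Dec (a ≡ b)
𝟘 ≟S 𝟘 = yes refl
𝟘 ≟S 𝟙 = no λ ()
𝟘 ≟S N = no λ ()
𝟙 ≟S 𝟘 = no λ ()
𝟙 ≟S 𝟙 = yes refl
𝟙 ≟S N = no λ ()
N ≟S 𝟘 = no λ ()
N ≟S 𝟙 = no λ ()
N ≟S N = yes refl

Fingerprint : ℕ → Set
Fingerprint l = Vec Sym l

numN : ∀ {l} → Fingerprint l → ℕ
numN v = count (λ a → a ≟S N) v

Compatible : ∀ {l} → Fingerprint l → Fingerprint l → Set
Compatible {l} v₁ v₂ =
  (i : Fin l) → lookup v₁ i ≢ lookup v₂ i → (lookup v₁ i ≡ N ⊎ lookup v₂ i ≡ N)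

compatible? : ∀ {l} (v₁ v₂ : Fingerprint l) → Dec (Compatible v₁ v₂)
compatible? v₁ v₂ = all? λ i →
  ¬? (lookup v₁ i ≟S lookup v₂ i) →-dec
    ((lookup v₁ i ≟S N) ⊎-dec (lookup v₂ i ≟S N))

bit : Bool → Sym
bit false = 𝟘
bit true  = 𝟙

Resolution : ∀ {l} → Vec Bool l → Fingerprint l → Set
Resolution {l} r v = (i : Fin l) → lookup v i ≢ N → bit (lookup r i) ≡ lookup v i

resolution? : ∀ {l} (r : Vec Bool l) (v : Fingerprint l) → Dec (Resolution r v)
resolution? r v = all? λ i →
  ¬? (lookup v i ≟S N) →-dec (bit (lookup r i) ≟S lookup v i)

-- Instances: F is given as a vector of n fingerprints, indexed by Fin n;
-- subsets of F are Bool-valued predicates on Fin n; unordered pairs {x,y}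
-- (x ≠ y) are represented as (x , y) with toℕ x < toℕ y, and sets of
-- unordered pairs by symmetric Bool-valued predicates.

FSet : ℕ → Set
FSet n = Fin n → Bool

PSet : ℕ → Set
PSet n = Fin n → Fin n → Bool

∣_∣₁ : ∀ {n} → FSet n → ℕ
∣ s ∣₁ = sum (tabulate λ x → if s x then 1 else 0)

∣_∣₂ : ∀ {n} → PSet n → ℕ
∣ P ∣₂ = sum (tabulate λ x → sum (tabulate λ y →
           if (toℕ x <ᵇ toℕ y) ∧ P x y then 1 else 0))

IsOECMV : ∀ {l n} → ℕ → Vec (Fingerprint l) n → Set
IsOECMV {l} {n} p F =
  ((x y : Fin n) → lookup F x ≡ lookup F y → x ≡ y) ×
  ((x : Fin n) → numN (lookup F x) ≤ p)

module _ {l n : ℕ} (F : Vec (Fingerprint l) n) where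

  compat : Fin n → Fin n → Bool
  compat x y = does (compatible? (lookup F x) (lookup F y))

  InR : Vec Bool l → Set
  InR r = Σ (Fin n) λ x → Resolution r (lookup F x)

  select : FSet n → Vec Bool l → FSet n
  select U r x = U x ∧ does (resolution? r (lookup F x))

  remove : FSet n → FSet n → FSet n
  remove U s x = U x ∧ not (s x)

  -- GreedyRun U rs : the sequence of choices rs is a valid run of the
  -- greedy while-loop started with current set U.
  data GreedyRun : ∀ {k} → FSet n → Vec (Vec Bool l) k → Set where
    done : ∀ {U} → ((x : Fin n) → U x ≡ false) → GreedyRun U []
    step : ∀ {k U r} {rs : Vec (Vec Bool l) k} →
           Σ (Fin n) (λ x → U x ≡ true) →
           InR r →
           ((r' : Vec Bool l) → InR r' →
              ∣ select U r' ∣₁ ≤ ∣ select U r ∣₁) →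
           GreedyRun (remove U (select U r)) rs →
           GreedyRun U (r ∷ rs)

  greedySets : ∀ {k} → FSet n → Vec (Vec Bool l) k → Vec (FSet n) k
  greedySets U []       = []
  greedySets U (r ∷ rs) = select U r ∷ greedySets (remove U (select U r)) rs

  allF : FSet n
  allF _ = true

  -- Partitions (given by a labelling of F; the classes are the fibres)

  Feasible : (Fin n → ℕ) → Set
  Feasible c = (x y : Fin n) → c x ≡ c y → Compatible (lookup F x) (lookup F y)

  LQ : (Fin n → ℕ) → PSet n
  LQ c x y = compat x y ∧ not (c x ≡ᵇ c y)

  cost : (Fin n → ℕ) → ℕ
  cost c = ∣ LQ c ∣₂

  Optimal : (Fin n → ℕ) → Set
  Optimal c = Feasible c × ((c' : Fin n → ℕ) → Feasible c' → cost c ≤ cost c')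

  Lset : FSet n → PSet n
  Lset s x y = compat x y ∧ (s x xor s y)

  LQW : (Fin n → ℕ) → FSet n → PSet n
  LQW c W x y = LQ c x y ∧ (W x ∨ W y)

-- Given A₁,…,A_k, produce D_i = A_i \ ⋃_{j<i} D_j  (u = ⋃ of the D's so far)
disjointify : ∀ {n k} → PSet n → Vec (PSet n) k → Vec (PSet n) k
disjointify u []       = []
disjointify u (A ∷ As) =
  let D = λ x y → A x y ∧ not (u x y)
  in D ∷ disjointify (λ x y → u x y ∨ D x y) As

∅₂ : ∀ {n} → PSet n
∅₂ _ _ = false

{-# OPTIONS --safe #-}
-- Let s be the i-th greedy set and U the fingerprints left when it was chosen.  The new pairs of
-- L(S,i) are the compatible pairs within U with exactly one end in s, and L(Opt,i) contains every
-- pair within U that touches s and is separated by Opt.  Count the former from their end x in s.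
-- If the other end lies in another Opt-class, the pair is separated.  Otherwise it lies in the
-- Opt-class of x within U, outside s.  That class is pairwise compatible, hence has a common
-- resolution, so by the greedy choice it is no larger than s; therefore its part outside s is no
-- larger than the part of s outside the class, and each member of the latter forms with x a
-- separated pair inside s.  Such pairs are reached from both ends, which costs the factor 2.
module Submission where

open import Defs
open import Data.Nat using (ℕ; _≤_; _*_)
open import Data.Fin using (Fin)
open import Data.Vec using (Vec; lookup; map)
open import Data.Bool using (Bool)

open import Data.Nat.Properties using (+-0-commutativeMonoid)
open import Algebra.Properties.CommutativeMonoid.Sum +-0-commutativeMonoid
  using (sum; ∑-distrib-+; ∑-comm; sum-cong-≗)
open import Data.Bool using (true; false; T; _∧_; _∨_; not; _xor_; if_then_else_)
open import Data.Bool.Properties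
  using (T-∧; T-∨; not-¬; ∧-comm; ∧-zeroʳ; ∧-identityʳ; ∨-comm; xor-comm; xor-same; ∧-commutativeMonoid)
open import Algebra.Bundles using (CommutativeMonoid)
open import Algebra.Properties.CommutativeSemigroup
  (CommutativeMonoid.commutativeSemigroup ∧-commutativeMonoid) using (x∙yz≈y∙xz)
open import Data.Empty using (⊥-elim)
open import Data.Fin using (zero; suc; toℕ)
open import Data.Fin.Properties using (toℕ-injective; any?)
open import Data.Nat using (zero; suc; _+_; _<ᵇ_; _≡ᵇ_; z≤n; s≤s)
open import Data.Nat.Properties
  using (≤-refl; ≤-trans; ≤-reflexive; +-mono-≤; +-monoˡ-≤; +-cancelˡ-≤; +-identityʳ;
         *-cancelˡ-≤; *-monoʳ-≤; ≡ᵇ⇒≡; ≡⇒≡ᵇ; module ≤-Reasoning)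
open import Data.Product using (∃-syntax; _×_; _,_; proj₁; proj₂)
open import Data.Sum using (_⊎_; inj₁; inj₂; [_,_])
import Data.Sum as Sum
import Data.Vec as Vec
open import Data.Vec using (_∷_)
open import Data.Vec.Properties using (lookup∘tabulate)
open import Function using (_∘_; flip; mk⇔; Equivalence)
open import Relation.Nullary using (Dec; does; yes; no; ¬_; contradiction)
open import Relation.Nullary.Decidable using (T?; _×-dec_; ¬?; does-⇔)
open import Relation.Binary.PropositionalEquality
  using (_≡_; _≢_; refl; sym; trans; subst; cong; cong₂; module ≡-Reasoning)

private variable
  l n : ℕ
  a b c d : Bool

T-∧⁻ : T (a ∧ b) → T a × T b
T-∧⁻ = Equivalence.to T-∧

T-∧⁺ : T a → T b → T (a ∧ b)
T-∧⁺ ta tb = Equivalence.from T-∧ (ta , tb)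

T-∨ˡ : T a → T (a ∨ b)
T-∨ˡ ta = Equivalence.from T-∨ (inj₁ ta)

T-not⁺ : ¬ T a → T (not a)
T-not⁺ {false} _  = _
T-not⁺ {true}  ¬a = ¬a _

T-not⁻ : T (not a) → ¬ T a
T-not⁻ {false} _ ()

T-xor⇒⊎ : T (a xor b) → T a ⊎ T b
T-xor⇒⊎ {true}  _   = inj₁ _
T-xor⇒⊎ {false} a⊕b = inj₂ a⊕b

T-xor-not : T a → T (a xor b) → T (not b)
T-xor-not {true} _ a⊕b = a⊕b

T-xor-∧ : T ((a ∧ b) xor (c ∧ d)) → T (a xor c) ⊎ T (b xor d)
T-xor-∧ {true}  {c = false} _  = inj₁ _
T-xor-∧ {false} {c = true}  _  = inj₁ _
T-xor-∧ {true}  {c = true}  h  = inj₂ h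
T-xor-∧ {false} {c = false} ()

T-xor-not-not : T (not a xor not b) → T (a xor b)
T-xor-not-not {true}          h = h
T-xor-not-not {false} {true}  _ = _
T-xor-not-not {false} {false} ()

T-⊎-¬xor⇒× : T a ⊎ T b → ¬ T (a xor b) → T a × T b
T-⊎-¬xor⇒× {true}  {true}  _ _    = _ , _
T-⊎-¬xor⇒× {true}  {false} _ ¬a⊕b = ⊥-elim (¬a⊕b _)
T-⊎-¬xor⇒× {false} {true}  _ ¬a⊕b = ⊥-elim (¬a⊕b _)
T-⊎-¬xor⇒× {false} {false} (inj₁ ())
T-⊎-¬xor⇒× {false} {false} (inj₂ ())

T-not-∧ : T (not (a ∧ b)) → T a → T (not b)
T-not-∧ {true} h _ = h

T-∨-∧-not⁺ : T a ⊎ T b → T (a ∨ (b ∧ not a))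
T-∨-∧-not⁺ {true}          _ = _
T-∨-∧-not⁺ {false} {true}  _ = _
T-∨-∧-not⁺ {false} {false} (inj₁ ())
T-∨-∧-not⁺ {false} {false} (inj₂ ())

T-∨-∧-not⁻ : T (a ∨ (b ∧ not a)) → T a ⊎ T b
T-∨-∧-not⁻ {true}          _ = inj₁ _
T-∨-∧-not⁻ {false} {true}  _ = inj₂ _

T-does⁻ : {A : Set} (a? : Dec A) → T (does a?) → A
T-does⁻ (yes a) _ = a

T-does⁺ : {A : Set} (a? : Dec A) → A → T (does a?)
T-does⁺ (yes _)  _ = _
T-does⁺ (no  ¬a) a = ¬a a

ind : Bool → ℕ
ind b = if b then 1 else 0

ind-mono : (T a → T b) → ind a ≤ ind b
ind-mono {false}         _   = z≤n
ind-mono {true} {true}   _   = ≤-refl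
ind-mono {true} {false}  a⇒b = ⊥-elim (a⇒b _)

ind-≤-+ : (T a → T b ⊎ T c) → ind a ≤ ind b + ind c
ind-≤-+ {false}                 _     = z≤n
ind-≤-+ {true} {true}           _     = s≤s z≤n
ind-≤-+ {true} {false} {true}   _     = ≤-refl
ind-≤-+ {true} {false} {false}  a⇒b∨c = ⊥-elim ([ (λ ()) , (λ ()) ] (a⇒b∨c _))

ind-split : ∀ a b → ind a ≡ ind (a ∧ b) + ind (a ∧ not b)
ind-split false _     = refl
ind-split true  true  = refl
ind-split true  false = refl

<ᵇ-exactly-one : ∀ m n → m ≢ n → ind (m <ᵇ n) + ind (n <ᵇ m) ≡ 1
<ᵇ-exactly-one zero    zero    m≢n = contradiction refl m≢n
<ᵇ-exactly-one zero    (suc n) _   = refl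
<ᵇ-exactly-one (suc m) zero    _   = refl
<ᵇ-exactly-one (suc m) (suc n) m≢n = <ᵇ-exactly-one m n (m≢n ∘ cong suc)

sum-tabulate : (f : Fin n → ℕ) → Vec.sum (Vec.tabulate f) ≡ sum f
sum-tabulate {zero}  f = refl
sum-tabulate {suc n} f = cong (f zero +_) (sum-tabulate (f ∘ suc))

∑-mono-≤ : {f g : Fin n → ℕ} → (∀ x → f x ≤ g x) → sum f ≤ sum g
∑-mono-≤ {zero}  f≤g = z≤n
∑-mono-≤ {suc n} f≤g = +-mono-≤ (f≤g zero) (∑-mono-≤ (f≤g ∘ suc))

∑-cong-+ : {f g h : Fin n → ℕ} → (∀ x → f x ≡ g x + h x) → sum f ≡ sum g + sum h
∑-cong-+ {g = g} {h} f≡g+h = trans (sum-cong-≗ f≡g+h) (∑-distrib-+ g h)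

∑-mono-+ : {f g h : Fin n → ℕ} → (∀ x → f x ≤ g x + h x) → sum f ≤ sum g + sum h
∑-mono-+ {g = g} {h} f≤g+h = ≤-trans (∑-mono-≤ f≤g+h) (≤-reflexive (∑-distrib-+ g h))

infix  4 _⊆_ _⊆²_
infixl 7 _∩_
infixl 6 _─_ _─²_ _∪²_

_⊆_ : FSet n → FSet n → Set
P ⊆ Q = ∀ {x} → T (P x) → T (Q x)

_⊆²_ : PSet n → PSet n → Set
P ⊆² Q = ∀ {x y} → T (P x y) → T (Q x y)

_∩_ _─_ : FSet n → FSet n → FSet n
(P ∩ Q) x = P x ∧ Q x
(P ─ Q) x = P x ∧ not (Q x)

_∪²_ _─²_ : PSet n → PSet n → PSet n
(P ∪² Q) x y = P x y ∨ Q x y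
(P ─² Q) x y = P x y ∧ not (Q x y)

size : FSet n → ℕ
size P = sum (ind ∘ P)

size-mono : {P Q : FSet n} → P ⊆ Q → size P ≤ size Q
size-mono P⊆Q = ∑-mono-≤ (λ x → ind-mono (P⊆Q {x}))

size-split : (P Q : FSet n) → size P ≡ size (P ∩ Q) + size (P ─ Q)
size-split P Q = ∑-cong-+ (λ x → ind-split (P x) (Q x))

size-─-≤ : (P Q : FSet n) → size P ≤ size Q → size (P ─ Q) ≤ size (Q ─ P)
size-─-≤ P Q P≤Q = +-cancelˡ-≤ (size (P ∩ Q)) _ _ (begin
  size (P ∩ Q) + size (P ─ Q) ≡⟨ size-split P Q ⟨
  size P                      ≤⟨ P≤Q ⟩
  size Q                      ≡⟨ size-split Q P ⟩
  size (Q ∩ P) + size (Q ─ P) ≡⟨ cong (_+ size (Q ─ P)) (sum-cong-≗ λ x → cong ind (∧-comm (Q x) (P x))) ⟩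
  size (P ∩ Q) + size (Q ─ P) ∎)
  where open ≤-Reasoning

sizeₒ : PSet n → ℕ
sizeₒ P = sum (size ∘ P)

sizeₒ-mono : {P Q : PSet n} → P ⊆² Q → sizeₒ P ≤ sizeₒ Q
sizeₒ-mono {P = P} {Q} P⊆Q = ∑-mono-≤ (λ x → size-mono {P = P x} {Q x} P⊆Q)

sizeₒ-mono-+ : {P Q R : PSet n} → (∀ x y → ind (P x y) ≤ ind (Q x y) + ind (R x y)) →
               sizeₒ P ≤ sizeₒ Q + sizeₒ R
sizeₒ-mono-+ p = ∑-mono-+ (λ x → ∑-mono-+ (p x))

sizeₒ-cong-+ : {P Q R : PSet n} → (∀ x y → ind (P x y) ≡ ind (Q x y) + ind (R x y)) →
               sizeₒ P ≡ sizeₒ Q + sizeₒ R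
sizeₒ-cong-+ p = ∑-cong-+ (λ x → ∑-cong-+ (p x))

sizeₒ-transpose : (P : PSet n) → sizeₒ (flip P) ≡ sizeₒ P
sizeₒ-transpose P = ∑-comm (λ x y → ind (P y x))

Symmetricᵇ Irreflexiveᵇ : PSet n → Set
Symmetricᵇ   P = ∀ x y → P x y ≡ P y x
Irreflexiveᵇ P = ∀ x → P x x ≡ false

ascending : PSet n → PSet n
ascending P x y = (toℕ x <ᵇ toℕ y) ∧ P x y

∣∣₁≡size : (P : FSet n) → ∣ P ∣₁ ≡ size P
∣∣₁≡size P = sum-tabulate (ind ∘ P)

∣∣₂≡sizeₒ : (P : PSet n) → ∣ P ∣₂ ≡ sizeₒ (ascending P)
∣∣₂≡sizeₒ P = trans (sum-tabulate (λ x → Vec.sum (Vec.tabulate (ind ∘ ascending P x))))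
                    (sum-cong-≗ λ x → sum-tabulate (ind ∘ ascending P x))

∣∣₂-mono : {P Q : PSet n} → P ⊆² Q → ∣ P ∣₂ ≤ ∣ Q ∣₂
∣∣₂-mono {P = P} {Q} P⊆Q = begin
  ∣ P ∣₂                ≡⟨ ∣∣₂≡sizeₒ P ⟩
  sizeₒ (ascending P)   ≤⟨ sizeₒ-mono {P = ascending P} {ascending Q}
                                       (λ h → let x<y , Pxy = T-∧⁻ h in T-∧⁺ x<y (P⊆Q Pxy)) ⟩
  sizeₒ (ascending Q)   ≡⟨ ∣∣₂≡sizeₒ Q ⟨
  ∣ Q ∣₂                ∎
  where open ≤-Reasoning

sizeₒ≡2*∣∣₂ : (P : PSet n) → Symmetricᵇ P → Irreflexiveᵇ P → sizeₒ P ≡ 2 * ∣ P ∣₂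
sizeₒ≡2*∣∣₂ P P-sym P-irrefl = begin
  sizeₒ P                  ≡⟨ sizeₒ-cong-+ split ⟩
  sizeₒ A + sizeₒ (flip A) ≡⟨ cong (sizeₒ A +_) (sizeₒ-transpose A) ⟩
  sizeₒ A + sizeₒ A        ≡⟨ cong (sizeₒ A +_) (+-identityʳ _) ⟨
  2 * sizeₒ A              ≡⟨ cong (2 *_) (∣∣₂≡sizeₒ P) ⟨
  2 * ∣ P ∣₂               ∎
  where
  open ≡-Reasoning
  A = ascending P
  split : ∀ x y → ind (P x y) ≡ ind (ascending P x y) + ind (ascending P y x)
  split x y rewrite P-sym y x with P x y in Pxy
  ... | false = sym (cong₂ _+_ (cong ind (∧-zeroʳ (toℕ x <ᵇ toℕ y)))
                               (cong ind (∧-zeroʳ (toℕ y <ᵇ toℕ x))))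
  ... | true  = sym (trans (cong₂ _+_ (cong ind (∧-identityʳ (toℕ x <ᵇ toℕ y)))
                                      (cong ind (∧-identityʳ (toℕ y <ᵇ toℕ x))))
                           (<ᵇ-exactly-one (toℕ x) (toℕ y) x≢y))
    where
    x≢y : toℕ x ≢ toℕ y
    x≢y x≡y = not-¬ (subst (λ z → P x z ≡ true) (sym (toℕ-injective x≡y)) Pxy) (P-irrefl x)

compatible-sym : {v w : Fingerprint l} → Compatible v w → Compatible w v
compatible-sym v~w i wi≢vi = Sum.swap (v~w i (wi≢vi ∘ sym))

compat-sym : (F : Vec (Fingerprint l) n) (x y : Fin n) → compat F x y ≡ compat F y x
compat-sym F x y = does-⇔ (mk⇔ (compatible-sym {v = lookup F x} {lookup F y})
                                (compatible-sym {v = lookup F y} {lookup F x}))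
                           (compatible? (lookup F x) (lookup F y)) (compatible? (lookup F y) (lookup F x))

compatible-agree : {v w : Fingerprint l} → Compatible v w → ∀ i →
                   lookup v i ≢ N → lookup w i ≢ N → lookup v i ≡ lookup w i
compatible-agree {v = v} {w} v~w i vi≢N wi≢N with lookup v i ≟S lookup w i
... | yes vi≡wi = vi≡wi
... | no  vi≢wi with v~w i vi≢wi
...   | inj₁ vi≡N = contradiction vi≡N vi≢N
...   | inj₂ wi≡N = contradiction wi≡N wi≢N

resolutions-compatible : {r : Vec Bool l} {v w : Fingerprint l} →
                         Resolution r v → Resolution r w → Compatible v w
resolutions-compatible {v = v} {w} r⊨v r⊨w i vi≢wi with lookup v i ≟S N | lookup w i ≟S N
... | yes vi≡N | _        = inj₁ vi≡N
... | no  _    | yes wi≡N = inj₂ wi≡N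
... | no  vi≢N | no  wi≢N = contradiction (trans (sym (r⊨v i vi≢N)) (r⊨w i wi≢N)) vi≢wi

toBool : Sym → Bool
toBool 𝟙 = true
toBool 𝟘 = false
toBool N = false

bit-toBool : ∀ {a} → a ≢ N → bit (toBool a) ≡ a
bit-toBool {𝟘} _   = refl
bit-toBool {𝟙} _   = refl
bit-toBool {N} a≢N = contradiction refl a≢N

-- At each position take the entry of some member of O that is not N there; by compatibility all
-- such entries agree.
common-resolution : (G : Vec (Fingerprint l) n) (O : FSet n) →
                    (∀ {x y} → T (O x) → T (O y) → Compatible (lookup G x) (lookup G y)) →
                    ∃[ r ] (∀ {x} → T (O x) → Resolution r (lookup G x))
common-resolution {l} G O O-compatible = Vec.tabulate resolveAt , resolves
  where
  specified? : ∀ i y → Dec (T (O y) × lookup (lookup G y) i ≢ N)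
  specified? i y = T? (O y) ×-dec ¬? (lookup (lookup G y) i ≟S N)

  resolveAt : Fin l → Bool
  resolveAt i with any? (specified? i)
  ... | yes (y , _) = toBool (lookup (lookup G y) i)
  ... | no  _       = false

  resolves : ∀ {x} → T (O x) → Resolution (Vec.tabulate resolveAt) (lookup G x)
  resolves {x} x∈O i xi≢N rewrite lookup∘tabulate resolveAt i with any? (specified? i)
  ... | yes (y , y∈O , yi≢N) =
    trans (bit-toBool yi≢N)
          (compatible-agree {v = lookup G y} {lookup G x} (O-compatible y∈O x∈O) i yi≢N xi≢N)
  ... | no  none = contradiction (x , x∈O , xi≢N) none

restrict : FSet n → PSet n → PSet n
restrict U P x y = U x ∧ (U y ∧ P x y)

sameLabel : (Fin n → ℕ) → PSet n
sameLabel c x y = c x ≡ᵇ c y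

≡ᵇ-sym : ∀ m n → (m ≡ᵇ n) ≡ (n ≡ᵇ m)
≡ᵇ-sym zero    zero    = refl
≡ᵇ-sym zero    (suc n) = refl
≡ᵇ-sym (suc m) zero    = refl
≡ᵇ-sym (suc m) (suc n) = ≡ᵇ-sym m n

≡ᵇ-refl : ∀ m → (m ≡ᵇ m) ≡ true
≡ᵇ-refl zero    = refl
≡ᵇ-refl (suc m) = ≡ᵇ-refl m

restrict-sym : (U : FSet n) (P : PSet n) → Symmetricᵇ P → Symmetricᵇ (restrict U P)
restrict-sym U P P-sym x y =
  trans (cong (λ p → U x ∧ (U y ∧ p)) (P-sym x y)) (x∙yz≈y∙xz (U x) (U y) (P y x))

restrict-irrefl : (U : FSet n) (P : PSet n) → Irreflexiveᵇ P → Irreflexiveᵇ (restrict U P)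
restrict-irrefl U P P-irrefl x =
  trans (cong (λ p → U x ∧ (U x ∧ p)) (P-irrefl x))
        (trans (cong (U x ∧_) (∧-zeroʳ (U x))) (∧-zeroʳ (U x)))

module _ {l n} (F : Vec (Fingerprint l) n) where

  Lset-sym : (s : FSet n) → Symmetricᵇ (Lset F s)
  Lset-sym s x y = cong₂ _∧_ (compat-sym F x y) (xor-comm (s x) (s y))

  Lset-irrefl : (s : FSet n) → Irreflexiveᵇ (Lset F s)
  Lset-irrefl s x = trans (cong (compat F x x ∧_) (xor-same (s x))) (∧-zeroʳ _)

  Lset-allF : Lset F (allF F) ⊆² ∅₂
  Lset-allF {x} h = proj₂ (T-∧⁻ {compat F x _} h)

  LQW-sym : (c : Fin n → ℕ) (s : FSet n) → Symmetricᵇ (LQW F c s)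
  LQW-sym c s x y =
    cong₂ _∧_ (cong₂ _∧_ (compat-sym F x y) (cong not (≡ᵇ-sym (c x) (c y)))) (∨-comm (s x) (s y))

  LQW-irrefl : (c : Fin n → ℕ) (s : FSet n) → Irreflexiveᵇ (LQW F c s)
  LQW-irrefl c s x rewrite ≡ᵇ-refl (c x) | ∧-zeroʳ (compat F x x) = refl

module CrossingBound {l n} (F : Vec (Fingerprint l) n) (c : Fin n → ℕ) (U s : FSet n)
  (s⊆U : s ⊆ U)
  (s-clique : ∀ {x y} → T (s x) → T (s y) → T (compat F x y))
  (class≤s : ∀ {x} → T (s x) → size (U ∩ sameLabel c x) ≤ size s) where

  crossing separated leaving : PSet n
  crossing    = restrict U (Lset F s)
  separated   = restrict U (LQW F c s)
  leaving x y = s x ∧ crossing x y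

  crossing⁻ : ∀ {x y} → T (crossing x y) → T (U x) × T (U y) × T (compat F x y) × T (s x xor s y)
  crossing⁻ h = let ux , h′ = T-∧⁻ h ; uy , h″ = T-∧⁻ h′ in ux , uy , T-∧⁻ h″

  separated⁺ : ∀ {x y} → T (U x) → T (U y) → T (compat F x y) → T (not (sameLabel c x y)) →
               T (s x) → T (separated x y)
  separated⁺ ux uy x~y x≁y sx = T-∧⁺ ux (T-∧⁺ uy (T-∧⁺ (T-∧⁺ x~y x≁y) (T-∨ˡ sx)))

  crossing-sym : Symmetricᵇ crossing
  crossing-sym = restrict-sym U (Lset F s) (Lset-sym F s)

  separated-sym : Symmetricᵇ separated
  separated-sym = restrict-sym U (LQW F c s) (LQW-sym F c s)

  crossing-irrefl : Irreflexiveᵇ crossing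
  crossing-irrefl = restrict-irrefl U (Lset F s) (Lset-irrefl F s)

  separated-irrefl : Irreflexiveᵇ separated
  separated-irrefl = restrict-irrefl U (LQW F c s) (LQW-irrefl F c s)

  crossing-touches : ∀ {x y} → T (crossing x y) → T (s x) ⊎ T (s y)
  crossing-touches h = let _ , _ , _ , s⊕ = crossing⁻ h in T-xor⇒⊎ s⊕

  crossing-leaves : ∀ x y → ind (crossing x y) ≤ ind (leaving x y) + ind (leaving y x)
  crossing-leaves x y = ind-≤-+ {crossing x y} {leaving x y} {leaving y x} λ h →
    Sum.map (λ sx → T-∧⁺ {s x} sx h)
            (λ sy → T-∧⁺ {s y} sy (subst T (crossing-sym x y) h))
            (crossing-touches {x} {y} h)

  leaving-other-class⊆separated : ∀ x → leaving x ─ sameLabel c x ⊆ separated x ─ s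
  leaving-other-class⊆separated x {y} h =
    let lv , x≁y = T-∧⁻ h ; sx , cr = T-∧⁻ {s x} lv ; ux , uy , x~y , s⊕ = crossing⁻ {x} {y} cr
    in T-∧⁺ (separated⁺ ux uy x~y x≁y sx) (T-xor-not sx s⊕)

  leaving-same-class⊆class : ∀ x → leaving x ∩ sameLabel c x ⊆ (U ∩ sameLabel c x) ─ s
  leaving-same-class⊆class x {y} h =
    let lv , x≈y = T-∧⁻ h ; sx , cr = T-∧⁻ {s x} lv ; _ , uy , _ , s⊕ = crossing⁻ {x} {y} cr
    in T-∧⁺ (T-∧⁺ uy x≈y) (T-xor-not sx s⊕)

  selected-other-class⊆separated : ∀ {x} → T (s x) → s ─ (U ∩ sameLabel c x) ⊆ separated x ∩ s
  selected-other-class⊆separated sx h = let sy , ¬class = T-∧⁻ h ; uy = s⊆U sy in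
    T-∧⁺ (separated⁺ (s⊆U sx) uy (s-clique sx sy) (T-not-∧ ¬class uy) sx) sy

  size-leaving≤separated : ∀ x → size (leaving x) ≤ size (separated x)
  size-leaving≤separated x with T? (s x)
  ... | no  x∉s = size-mono {P = leaving x} (λ h → contradiction (proj₁ (T-∧⁻ h)) x∉s)
  ... | yes x∈s = begin
    size (leaving x)
      ≡⟨ size-split (leaving x) same ⟩
    size (leaving x ∩ same) + size (leaving x ─ same)
      ≤⟨ +-mono-≤ (size-mono (λ {y} → leaving-same-class⊆class x {y}))
                  (size-mono (λ {y} → leaving-other-class⊆separated x {y})) ⟩
    size (class ─ s) + size (separated x ─ s)
      ≤⟨ +-monoˡ-≤ _ (size-─-≤ class s (class≤s x∈s)) ⟩
    size (s ─ class) + size (separated x ─ s)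
      ≤⟨ +-monoˡ-≤ _ (size-mono (λ {y} → selected-other-class⊆separated x∈s {y})) ⟩
    size (separated x ∩ s) + size (separated x ─ s)
      ≡⟨ size-split (separated x) s ⟨
    size (separated x)
      ∎
    where
    open ≤-Reasoning
    same  = sameLabel c x
    class = U ∩ same

  crossing≤2*separated : ∣ crossing ∣₂ ≤ 2 * ∣ separated ∣₂
  crossing≤2*separated = *-cancelˡ-≤ 2 (begin
    2 * ∣ crossing ∣₂                    ≡⟨ sizeₒ≡2*∣∣₂ crossing crossing-sym crossing-irrefl ⟨
    sizeₒ crossing                       ≤⟨ sizeₒ-mono-+ {Q = leaving} {flip leaving} crossing-leaves ⟩
    sizeₒ leaving + sizeₒ (flip leaving) ≡⟨ cong (sizeₒ leaving +_) (sizeₒ-transpose leaving) ⟩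
    sizeₒ leaving + sizeₒ leaving        ≡⟨ cong (sizeₒ leaving +_) (+-identityʳ _) ⟨
    2 * sizeₒ leaving                    ≤⟨ *-monoʳ-≤ 2 (∑-mono-≤ size-leaving≤separated) ⟩
    2 * sizeₒ separated                  ≡⟨ cong (2 *_) (sizeₒ≡2*∣∣₂ separated separated-sym separated-irrefl) ⟩
    2 * (2 * ∣ separated ∣₂)             ∎)
    where open ≤-Reasoning

NoPairIn : FSet n → PSet n → Set
NoPairIn U P = ∀ {x y} → T (U x) → T (U y) → ¬ T (P x y)

module GreedyBound {l n} (F : Vec (Fingerprint l) n) (c : Fin n → ℕ) (c-feasible : Feasible F c) where

  GreedyChoice : FSet n → Vec Bool l → Set
  GreedyChoice U r = (r′ : Vec Bool l) → InR F r′ → ∣ select F U r′ ∣₁ ≤ ∣ select F U r ∣₁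

  select⊆ : (U : FSet n) (r : Vec Bool l) → select F U r ⊆ U
  select⊆ U r {x} = proj₁ ∘ T-∧⁻ {U x}

  select-clique : (U : FSet n) (r : Vec Bool l) → ∀ {x y} →
                  T (select F U r x) → T (select F U r y) → T (compat F x y)
  select-clique U r {x} {y} x∈s y∈s = T-does⁺ (compatible? (lookup F x) (lookup F y))
    (resolutions-compatible {r = r} {lookup F x} {lookup F y}
      (T-does⁻ (resolution? r (lookup F x)) (proj₂ (T-∧⁻ {U x} x∈s)))
      (T-does⁻ (resolution? r (lookup F y)) (proj₂ (T-∧⁻ {U y} y∈s))))

  class≤selection : (U : FSet n) (r : Vec Bool l) → GreedyChoice U r →
                    ∀ {x} → T (select F U r x) → size (U ∩ sameLabel c x) ≤ size (select F U r)
  class≤selection U r r-greedy {x} x∈s = begin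
    size class            ≤⟨ size-mono {P = class} {select F U r′} class⊆selection ⟩
    size (select F U r′)  ≡⟨ ∣∣₁≡size (select F U r′) ⟨
    ∣ select F U r′ ∣₁    ≤⟨ r-greedy r′ (x , r′-resolves x∈class) ⟩
    ∣ select F U r ∣₁     ≡⟨ ∣∣₁≡size (select F U r) ⟩
    size (select F U r)   ∎
    where
    open ≤-Reasoning
    class = U ∩ sameLabel c x

    class-compatible : ∀ {y z} → T (class y) → T (class z) → Compatible (lookup F y) (lookup F z)
    class-compatible {y} {z} y∈class z∈class = c-feasible y z (trans
      (sym (≡ᵇ⇒≡ (c x) (c y) (proj₂ (T-∧⁻ {U y} y∈class))))
      (≡ᵇ⇒≡ (c x) (c z) (proj₂ (T-∧⁻ {U z} z∈class))))

    r′ = proj₁ (common-resolution F class class-compatible)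
    r′-resolves = proj₂ (common-resolution F class class-compatible)

    x∈class : T (class x)
    x∈class = T-∧⁺ (select⊆ U r x∈s) (≡⇒≡ᵇ (c x) (c x) refl)

    class⊆selection : class ⊆ select F U r′
    class⊆selection {y} y∈class =
      T-∧⁺ (proj₁ (T-∧⁻ {U y} y∈class)) (T-does⁺ (resolution? r′ (lookup F y)) (r′-resolves y∈class))

  uncounted-inside : ∀ {U s : FSet n} {uS : PSet n} → s ⊆ U → Lset F U ⊆² uS →
                     Lset F s ─² uS ⊆² restrict U (Lset F s)
  uncounted-inside {U} {s} {uS} s⊆U L⊆uS {x} {y} h =
    let lxy , ¬uS = T-∧⁻ {Lset F s x y} h
        x~y , s⊕  = T-∧⁻ {compat F x y} lxy
        ux , uy   = T-⊎-¬xor⇒× (Sum.map s⊆U s⊆U (T-xor⇒⊎ {s x} s⊕))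
                               (λ u⊕ → T-not⁻ ¬uS (L⊆uS (T-∧⁺ x~y u⊕)))
    in T-∧⁺ ux (T-∧⁺ uy lxy)

  inside-uncounted : ∀ {U : FSet n} {P uO : PSet n} → NoPairIn U uO → restrict U P ⊆² P ─² uO
  inside-uncounted {U} {P} no-uO {x} {y} h =
    let ux , h′ = T-∧⁻ {U x} h ; uy , p = T-∧⁻ {U y} h′ in T-∧⁺ {P x y} p (T-not⁺ (no-uO {x} {y} ux uy))

  -- A pair with exactly one end in U ∩ ∁s has exactly one end in U or exactly one in s.
  boundary-step : ∀ {U s : FSet n} {uS : PSet n} → Lset F U ⊆² uS →
                  Lset F (U ─ s) ⊆² uS ∪² (Lset F s ─² uS)
  boundary-step {U} {s} {uS} L⊆uS {x} {y} h =
    let x~y , u′⊕ = T-∧⁻ {compat F x y} h in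
    T-∨-∧-not⁺ {uS x y} (Sum.map (λ u⊕ → L⊆uS (T-∧⁺ x~y u⊕))
                                 (λ ¬s⊕ → T-∧⁺ x~y (T-xor-not-not {s x} ¬s⊕))
                                 (T-xor-∧ {U x} {c = U y} u′⊕))

  no-pair-step : ∀ {U s : FSet n} {uO : PSet n} → NoPairIn U uO →
                 NoPairIn (U ─ s) (uO ∪² (LQW F c s ─² uO))
  no-pair-step {U} {s} {uO} no-uO {x} {y} x∈U′ y∈U′ h with T-∨-∧-not⁻ {uO x y} h
  ... | inj₁ o = no-uO (proj₁ (T-∧⁻ {U x} x∈U′)) (proj₁ (T-∧⁻ {U y} y∈U′)) o
  ... | inj₂ q = [ T-not⁻ (proj₂ (T-∧⁻ {U x} x∈U′)) , T-not⁻ (proj₂ (T-∧⁻ {U y} y∈U′)) ]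
                   (Equivalence.to T-∨ (proj₂ (T-∧⁻ {LQ F c x y} q)))

  -- uS and uO stand for the unions that disjointify has accumulated from the sets already output.
  run-bound : ∀ {k} (U : FSet n) (rs : Vec (Vec Bool l) k) → GreedyRun F U rs →
              (uS uO : PSet n) → Lset F U ⊆² uS → NoPairIn U uO → (i : Fin k) →
              ∣ lookup (disjointify uS (map (Lset F) (greedySets F U rs))) i ∣₂
                ≤ 2 * ∣ lookup (disjointify uO (map (LQW F c) (greedySets F U rs))) i ∣₂
  run-bound U (r ∷ rs) (step _ _ r-greedy _) uS uO L⊆uS no-uO zero = begin
    ∣ Lset F s ─² uS ∣₂       ≤⟨ ∣∣₂-mono {P = Lset F s ─² uS} {crossing}
                                           (uncounted-inside (select⊆ U r) L⊆uS) ⟩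
    ∣ crossing ∣₂             ≤⟨ crossing≤2*separated ⟩
    2 * ∣ separated ∣₂        ≤⟨ *-monoʳ-≤ 2 (∣∣₂-mono {P = separated} {LQW F c s ─² uO}
                                                      (inside-uncounted {U} {LQW F c s} no-uO)) ⟩
    2 * ∣ LQW F c s ─² uO ∣₂  ∎
    where
    open ≤-Reasoning
    s = select F U r
    open CrossingBound F c U s (select⊆ U r) (select-clique U r) (class≤selection U r r-greedy)
  run-bound U (r ∷ rs) (step _ _ _ run) uS uO L⊆uS no-uO (suc i) =
    run-bound (remove F U s) rs run _ _ (boundary-step {U} {s} {uS} L⊆uS)
                                        (no-pair-step {U} {s} {uO} no-uO) i
    where s = select F U r

lemma3p2 : (p l n k : ℕ) (F : Vec (Fingerprint l) n) → IsOECMV p F →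
           (rs : Vec (Vec Bool l) k) → GreedyRun F (allF F) rs →
           (opt : Fin n → ℕ) → Optimal F opt →
           (i : Fin k) →
           ∣ lookup (disjointify ∅₂ (map (Lset F) (greedySets F (allF F) rs))) i ∣₂
             ≤ 2 * ∣ lookup (disjointify ∅₂ (map (LQW F opt) (greedySets F (allF F) rs))) i ∣₂
lemma3p2 _ _ _ _ F _ rs run opt (opt-feasible , _) =
  GreedyBound.run-bound F opt opt-feasible (allF F) rs run ∅₂ ∅₂ (Lset-allF F) (λ _ _ ())
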